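{- For every impartial game $G$, $\mathbf N\notin o(N\cdot G)$, where $N\cdot G$ is the disjunctive sum of $N$ copies of $G$ and $N$ is the number of players.
   Context: All games are short impartial games (identified with the finite set of their options, no infinite runs); $+$ is the disjunctive sum. There are $N\ge 2$ players moving cyclically; under normal play the player unable to move on their turn is the unique loser. Relative to a position, the players are $\mathbf N=\mathbf O_0$ (next to move), $\mathbf O_1,\dots,\mathbf O_{N-2}$, $\mathbf P=\mathbf O_{N-1}$, where $\mathbf O_i$ moves $i$ turns after $\mathbf N$. The outcome $o(G)$ is defined recursively: $\mathbf N\in o(G)$ iff some option $G'$ has $\mathbf P\in o(G')$; for $1\le i\le N-1$, $\mathbf O_i\in o(G)$ iff every option $G'$ has $\mathbf O_{i-1}\in o(G')$. -}

module Defs where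

open import Data.Nat using (ℕ; zero; suc)
open import Data.Fin using (Fin; zero; suc; fromℕ; inject₁)
open import Data.List using (List; []; _∷_; _++_)
open import Data.Product using (Σ; _×_; _,_)
open import Data.Sum using (_⊎_)
open import Data.Unit using (⊤)
open import Data.Empty using (⊥)

data Game : Set where
  node : List Game → Game

mutual
  _⊕_ : Game → Game → Game
  node gs ⊕ node hs = node (leftOpts gs (node hs) ++ rightOpts (node gs) hs)

  leftOpts : List Game → Game → List Game
  leftOpts [] h = []
  leftOpts (g ∷ gs) h = (g ⊕ h) ∷ leftOpts gs h

  rightOpts : Game → List Game → List Game
  rightOpts g [] = []
  rightOpts g (h ∷ hs) = (g ⊕ h) ∷ rightOpts g hs

infixl 6 _⊕_

copies : ℕ → Game → Game
copies zero g = node []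
copies (suc k) g = g ⊕ copies k g

-- Outcome with (suc n) players, cyclic play. Players relative to a position are
-- indexed by Fin (suc n): zero = N = O_0, i = O_i, fromℕ n = P = O_{N-1}.
-- Membership  i ∈ o(G)  is  InOutcome n G i.
mutual
  InOutcome : (n : ℕ) → Game → Fin (suc n) → Set
  InOutcome n (node gs) zero = SomeP n gs
  InOutcome n (node gs) (suc i) = AllO n gs (inject₁ i)

  SomeP : (n : ℕ) → List Game → Set
  SomeP n [] = ⊥
  SomeP n (g ∷ gs) = InOutcome n g (fromℕ n) ⊎ SomeP n gs

  AllO : (n : ℕ) → List Game → Fin (suc n) → Set
  AllO n [] j = ⊤
  AllO n (g ∷ gs) j = InOutcome n g j × AllO n gs j

module Submission where

-- Write N = n + 1 and suppose the next player N wins N·G.  Then N has a move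
-- to a position x with P = O_n ∈ o(x); such a move replaces one copy of G by
-- an option G' and leaves n copies of G.  Whenever O_c holds for a sum made of
-- copies of G and G' with exactly c copies of G left (c ≥ 1), every option has
-- O_{c-1}; in particular so does the option replacing one more G by G'.  After
-- n such steps N = O_0 holds for N·G', contradicting the claim for the option
-- G' of G, which we may assume by induction on games.  The argument works for
-- any number of players.

open import Defs
open import Data.Nat using (ℕ; zero; suc; _≥_)
open import Data.Nat.Properties using (suc-injective)
open import Data.Fin using (Fin; zero; suc; toℕ; fromℕ; inject₁)
open import Data.Fin.Properties using (toℕ-fromℕ; toℕ-inject₁)
open import Data.Bool using (Bool; true; false)
open import Data.List using (List; []; _∷_; map)
open import Data.List.Membership.Propositional using (_∈_)
open import Data.List.Membership.Propositional.Properties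
  using (∈-map⁺; ∈-map⁻; ∈-++⁺ˡ; ∈-++⁺ʳ; ∈-++⁻)
open import Data.List.Relation.Unary.Any using (here; there)
open import Data.Vec using (Vec; []; _∷_; replicate)
open import Data.Product using (∃; _×_; _,_)
open import Data.Sum using (_⊎_; inj₁; inj₂)
open import Relation.Nullary using (¬_)
open import Relation.Binary.PropositionalEquality
  using (_≡_; refl; sym; cong; subst; trans)

options : Game → List Game
options (node gs) = gs

module _ (P : Game → Set) (step : ∀ g → (∀ {g'} → g' ∈ options g → P g') → P g) where
  mutual
    game-induction : ∀ g → P g
    game-induction (node gs) = step (node gs) (optionsSatisfy gs)

    optionsSatisfy : ∀ gs {g'} → g' ∈ gs → P g'
    optionsSatisfy (g ∷ gs) (here refl) = game-induction g
    optionsSatisfy (g ∷ gs) (there g'∈gs) = optionsSatisfy gs g'∈gs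

N-winning-move : ∀ {n} g → InOutcome n g zero →
  ∃ λ g' → g' ∈ options g × InOutcome n g' (fromℕ n)
N-winning-move (node gs) = witness gs
  where
  witness : ∀ {n} gs → SomeP n gs → ∃ λ g' → g' ∈ gs × InOutcome n g' (fromℕ n)
  witness (g ∷ gs) (inj₁ Pg) = g , here refl , Pg
  witness (g ∷ gs) (inj₂ rest) with witness gs rest
  ... | g' , g'∈gs , Pg' = g' , there g'∈gs , Pg'

O-step : ∀ {n} g (i : Fin n) → InOutcome n g (suc i) →
  ∀ {g'} → g' ∈ options g → InOutcome n g' (inject₁ i)
O-step (node gs) i = everyOption gs
  where
  everyOption : ∀ {n j} gs → AllO n gs j → ∀ {g'} → g' ∈ gs → InOutcome n g' j
  everyOption (g ∷ gs) (Og , _) (here refl) = Og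
  everyOption (g ∷ gs) (_ , rest) (there g'∈gs) = everyOption gs rest g'∈gs

leftOpts-map : ∀ gs h → leftOpts gs h ≡ map (_⊕ h) gs
leftOpts-map [] h = refl
leftOpts-map (g ∷ gs) h = cong ((g ⊕ h) ∷_) (leftOpts-map gs h)

rightOpts-map : ∀ g hs → rightOpts g hs ≡ map (g ⊕_) hs
rightOpts-map g [] = refl
rightOpts-map g (h ∷ hs) = cong ((g ⊕ h) ∷_) (rightOpts-map g hs)

⊕-moveˡ : ∀ g h {g'} → g' ∈ options g → g' ⊕ h ∈ options (g ⊕ h)
⊕-moveˡ (node gs) (node hs) g'∈gs rewrite leftOpts-map gs (node hs) =
  ∈-++⁺ˡ (∈-map⁺ (_⊕ node hs) g'∈gs)

⊕-moveʳ : ∀ g h {h'} → h' ∈ options h → g ⊕ h' ∈ options (g ⊕ h)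
⊕-moveʳ (node gs) (node hs) h'∈hs
  rewrite leftOpts-map gs (node hs) | rightOpts-map (node gs) hs =
  ∈-++⁺ʳ (map (_⊕ node hs) gs) (∈-map⁺ (node gs ⊕_) h'∈hs)

⊕-options : ∀ g h {x} → x ∈ options (g ⊕ h) →
  (∃ λ g' → g' ∈ options g × x ≡ g' ⊕ h) ⊎ (∃ λ h' → h' ∈ options h × x ≡ g ⊕ h')
⊕-options (node gs) (node hs) x∈
  rewrite leftOpts-map gs (node hs) | rightOpts-map (node gs) hs
  with ∈-++⁻ (map (_⊕ node hs) gs) x∈
... | inj₁ left = inj₁ (∈-map⁻ (_⊕ node hs) left)
... | inj₂ right = inj₂ (∈-map⁻ (node gs ⊕_) right)

-- Mixed sums of copies of G and of a game G'.  A mark `false` stands for a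
-- copy of G, a mark `true` for a copy of G'; #G counts the copies of G.
module Mixed (G G' : Game) where
  slot : Bool → Game
  slot true = G'
  slot false = G

  mixed : ∀ {m} → Vec Bool m → Game
  mixed [] = node []
  mixed (b ∷ bs) = slot b ⊕ mixed bs

  #G : ∀ {m} → Vec Bool m → ℕ
  #G [] = 0
  #G (true ∷ bs) = #G bs
  #G (false ∷ bs) = suc (#G bs)

  mixed-allG : ∀ m → mixed (replicate m false) ≡ copies m G
  mixed-allG zero = refl
  mixed-allG (suc m) = cong (G ⊕_) (mixed-allG m)

  #G-allG : ∀ m → #G (replicate m false) ≡ m
  #G-allG zero = refl
  #G-allG (suc m) = cong suc (#G-allG m)

  mixed-noG : ∀ {m} (bs : Vec Bool m) → #G bs ≡ 0 → mixed bs ≡ copies m G'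
  mixed-noG [] _ = refl
  mixed-noG (true ∷ bs) noG = cong (G' ⊕_) (mixed-noG bs noG)

  replaceFirst : ∀ {m} → Vec Bool m → Vec Bool m
  replaceFirst [] = []
  replaceFirst (true ∷ bs) = true ∷ replaceFirst bs
  replaceFirst (false ∷ bs) = true ∷ bs

  replaceFirst-#G : ∀ {m c} (bs : Vec Bool m) → #G bs ≡ suc c → #G (replaceFirst bs) ≡ c
  replaceFirst-#G (true ∷ bs) count = replaceFirst-#G bs count
  replaceFirst-#G (false ∷ bs) count = suc-injective count

  replaceFirst-move : G' ∈ options G → ∀ {m c} (bs : Vec Bool m) → #G bs ≡ suc c →
    mixed (replaceFirst bs) ∈ options (mixed bs)
  replaceFirst-move G'∈G (true ∷ bs) count = ⊕-moveʳ G' (mixed bs) (replaceFirst-move G'∈G bs count)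
  replaceFirst-move G'∈G (false ∷ bs) count = ⊕-moveˡ G (mixed bs) G'∈G

  descent : G' ∈ options G → ∀ {n} c {m} (bs : Vec Bool m) (j : Fin (suc n)) →
    #G bs ≡ c → toℕ j ≡ c → InOutcome n (mixed bs) j → InOutcome n (copies m G') zero
  descent G'∈G zero bs zero noG _ N-wins =
    subst (λ g → InOutcome _ g zero) (mixed-noG bs noG) N-wins
  descent G'∈G {suc n} (suc c) bs (suc i) count index O-holds =
    descent G'∈G c (replaceFirst bs) (inject₁ i)
      (replaceFirst-#G bs count)
      (trans (toℕ-inject₁ i) (suc-injective index))
      (O-step (mixed bs) i O-holds (replaceFirst-move G'∈G bs count))

first-move : ∀ G k {x} → x ∈ options (copies (suc k) G) →
  ∃ λ G' → G' ∈ options G × ∃ λ (bs : Vec Bool (suc k)) →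
    x ≡ Mixed.mixed G G' bs × Mixed.#G G G' bs ≡ k
first-move G k x∈ with ⊕-options G (copies k G) x∈
... | inj₁ (G' , G'∈G , refl) =
  G' , G'∈G , true ∷ replicate k false ,
  cong (G' ⊕_) (sym (Mixed.mixed-allG G G' k)) , Mixed.#G-allG G G' k
first-move G (suc k) x∈ | inj₂ (y , y∈ , refl) with first-move G k y∈
... | G' , G'∈G , bs , refl , count = G' , G'∈G , false ∷ bs , refl , cong suc count

mainTheorem7 : (n : ℕ) → suc n ≥ 2 → (G : Game) → ¬ InOutcome n (copies (suc n) G) zero
mainTheorem7 n _ = game-induction (λ G → ¬ InOutcome n (copies (suc n) G) zero) step
  where
  step : ∀ G → (∀ {G'} → G' ∈ options G → ¬ InOutcome n (copies (suc n) G') zero) →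
    ¬ InOutcome n (copies (suc n) G) zero
  step G optionsLose N-wins with N-winning-move (copies (suc n) G) N-wins
  ... | x , x∈ , P-wins with first-move G n x∈
  ... | G' , G'∈G , bs , refl , count =
    optionsLose G'∈G
      (Mixed.descent G G' G'∈G n bs (fromℕ n) count (toℕ-fromℕ n) P-wins)
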